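{- Let $V$ be an $n$-dimensional vector space over $\mathbb{F}_q$, let $k$ be a positive integer with $k\le n/2$, and let $\mathcal{S}^*$ be a family of $s$ subspaces of $V$ of codimension $k$, with $s\ge 2$, such that for some integer $d\ge2$: (1) for every $v\in V\setminus\{0\}$, $|\{M\in\mathcal{S}^*: v\in M\}|\in\{0,d\}$, with both values occurring; and (2) $\dim(M\cap M^*)=n-2k$ for all distinct $M,M^*\in\mathcal{S}^*$. Then \[ s=\frac{(d-1)(q^{n-k}-1)}{q^{n-2k}-1}+1=\frac{d(q^{n-k}-1)-q^{n-2k}(q^k-1)}{q^{n-2k}-1}. \] -}

module Defs where

open import Level using (0ℓ)
open import Algebra.Bundles using (CommutativeRing)
open import Data.Nat using (ℕ; zero; suc)
open import Data.Fin using (Fin; zero; suc)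
open import Data.Product using (Σ; _×_; _,_; ∃)
open import Relation.Nullary using (¬_; Dec; yes; no)
open import Relation.Binary.PropositionalEquality using (_≡_)

record Field : Set₁ where
  field
    commRing : CommutativeRing 0ℓ 0ℓ
  open CommutativeRing commRing public hiding (ring)
  field
    0≉1 : ¬ (0# ≈ 1#)
    inverse : ∀ x → ¬ (x ≈ 0#) → Σ Carrier (λ y → x * y ≈ 1#)

record FiniteField (q : ℕ) : Set₁ where
  field
    field' : Field
  open Field field' public hiding (commRing)
  field
    enum      : Fin q → Carrier
    enum-inj  : ∀ i j → enum i ≈ enum j → i ≡ j
    enum-surj : ∀ x → Σ (Fin q) (λ i → enum i ≈ x)

module _ (F : Field) where
  open Field F using (Carrier; _≈_; _+_; _*_; 0#)

  Vect : ℕ → Set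
  Vect n = Fin n → Carrier

  _≈ᵥ_ : ∀ {n} → Vect n → Vect n → Set
  u ≈ᵥ v = ∀ i → u i ≈ v i

  0ᵥ : ∀ {n} → Vect n
  0ᵥ _ = 0#

  _+ᵥ_ : ∀ {n} → Vect n → Vect n → Vect n
  (u +ᵥ v) i = u i + v i

  _·ᵥ_ : ∀ {n} → Carrier → Vect n → Vect n
  (a ·ᵥ v) i = a * v i

  NonZeroVec : ∀ {n} → Vect n → Set
  NonZeroVec v = ¬ (v ≈ᵥ 0ᵥ)

  lincomb : ∀ {n m} → (Fin m → Carrier) → (Fin m → Vect n) → Vect n
  lincomb {m = zero}  c b = 0ᵥ
  lincomb {m = suc m} c b = (c zero ·ᵥ b zero) +ᵥ lincomb (λ i → c (suc i)) (λ i → b (suc i))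

  LinearlyIndependent : ∀ {n m} → (Fin m → Vect n) → Set
  LinearlyIndependent b = ∀ c → lincomb c b ≈ᵥ 0ᵥ → ∀ i → c i ≈ 0#

  HasDim : ∀ {n} → (Vect n → Set) → ℕ → Set
  HasDim {n} P m = Σ (Fin m → Vect n) λ b →
      (∀ i → P (b i)) × LinearlyIndependent b
    × (∀ v → P v → Σ (Fin m → Carrier) (λ c → v ≈ᵥ lincomb c b))

  record Subspace (n : ℕ) : Set₁ where
    field
      _∈S : Vect n → Set
      ∈-resp : ∀ {u v} → u ≈ᵥ v → u ∈S → v ∈S
      0∈     : 0ᵥ ∈S
      +∈     : ∀ {u v} → u ∈S → v ∈S → (u +ᵥ v) ∈S
      ·∈     : ∀ a {v} → v ∈S → (a ·ᵥ v) ∈S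
      ∈?     : ∀ v → Dec (v ∈S)

  open Subspace public

  SameSubspace : ∀ {n} → Subspace n → Subspace n → Set
  SameSubspace M N = ∀ v → (_∈S M v → _∈S N v) × (_∈S N v → _∈S M v)

  count : ∀ {n s} → (Fin s → Subspace n) → Vect n → ℕ
  count {s = zero}  M v = 0
  count {s = suc s} M v with ∈? (M zero) v
  ... | yes _ = suc (count (λ i → M (suc i)) v)
  ... | no  _ = count (λ i → M (suc i)) v

{-# OPTIONS --safe #-}
-- Double count the pairs (v, j) with v ∈ M₀ ∩ M j for one fixed member M₀ of the family.
-- A subspace with a basis of m vectors has q^m elements, so counting by j gives
-- q^(n-k) + (s-1) q^(n-2k). Counting by v instead, the zero vector lies in all s members and
-- every other vector of M₀ lies in exactly d of them (a count of 0 is impossible inside M₀),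
-- giving s + d (q^(n-k) - 1). Equating the two and using q^(n-k) = q^(n-2k) q^k yields both
-- formulas.

module Submission where

open import Defs
open import Algebra.Bundles using (CommutativeRing)
import Algebra.Properties.AbelianGroup as AbelianGroupProperties
import Algebra.Properties.CommutativeSemigroup as CommutativeSemigroupProperties
import Algebra.Properties.Group as GroupProperties
import Algebra.Properties.Ring as RingProperties
open import Data.Bool.Base using (if_then_else_)
open import Data.Empty using (⊥-elim)
open import Data.Fin using (Fin; zero; suc; _≟_; combine; funToFin; finToFun)
open import Data.Fin.Properties using (funToFin-finToFin; finToFun-funToFin; nonZeroIndex)
open import Data.Nat using (ℕ; zero; suc; _+_; _*_; _∸_; _^_; _≤_; s≤s; s≤s⁻¹; NonZero; >-nonZero)
open import Data.Nat.Properties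
  using ( +-*-semiring; +-comm; +-assoc; *-identityʳ; +-cancelˡ-≡; *-distribˡ-∸; ^-distribˡ-+-*
        ; +-identityʳ; m≤m*n; m^n>0; m∸n+n≡m; m+n∸n≡m; +-∸-comm; m∸n≤m; m∸[m∸n]≡n )
open import Data.Nat.Tactic.RingSolver using (solve)
open import Data.List using (_∷_; [])
open import Data.Product using (Σ; _×_; _,_; proj₁; proj₂; ∃)
open import Data.Sum using (_⊎_; fromInj₂)
open import Function using (_∘_)
open import Function.Definitions using (Injective)
open import Relation.Nullary using (¬_; Dec; yes; no; does; _×-dec_)
open import Relation.Binary.PropositionalEquality as ≡ using (_≡_; _≢_; cong; cong₂; subst)
open import Algebra.Properties.Semiring.Sum +-*-semiring
  using (sum-syntax; ∑-comm; ∑-distrib-+; *-distribˡ-sum; sum-cong-≗; sum-replicate-zero)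

-- Defined through does, so that 𝟙 (suc i ≟ suc j) reduces to 𝟙 (i ≟ j).
𝟙 : ∀ {a} {A : Set a} → Dec A → ℕ
𝟙 A? = if does A? then 1 else 0

𝟙-cong : ∀ {a b} {A : Set a} {B : Set b} → (A → B) → (B → A) → (A? : Dec A) (B? : Dec B) → 𝟙 A? ≡ 𝟙 B?
𝟙-cong f g (yes _) (yes _) = ≡.refl
𝟙-cong f g (yes a) (no ¬b) = ⊥-elim (¬b (f a))
𝟙-cong f g (no ¬a) (yes b) = ⊥-elim (¬a (g b))
𝟙-cong f g (no _)  (no _)  = ≡.refl

𝟙-×-dec : ∀ {a b} {A : Set a} {B : Set b} (A? : Dec A) (B? : Dec B) → 𝟙 (A? ×-dec B?) ≡ 𝟙 A? * 𝟙 B?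
𝟙-×-dec (yes _) (yes _) = ≡.refl
𝟙-×-dec (yes _) (no _)  = ≡.refl
𝟙-×-dec (no _)  _       = ≡.refl

∑-const : ∀ n x → ∑[ i < n ] x ≡ n * x
∑-const zero    x = ≡.refl
∑-const (suc n) x = cong (x +_) (∑-const n x)

∑-𝟙≟ : ∀ {n} (i : Fin n) → ∑[ j < n ] 𝟙 (i ≟ j) ≡ 1
∑-𝟙≟ {suc n} zero = cong suc (sum-replicate-zero n)
∑-𝟙≟ (suc i)      = ∑-𝟙≟ i

∑-+-point-mass : ∀ {n} (f : Fin n → ℕ) c (o : Fin n) → ∑[ i < n ] (f i + c * 𝟙 (o ≟ i)) ≡ ∑[ i < n ] f i + c
∑-+-point-mass {n} f c o = begin
  ∑[ i < n ] (f i + c * 𝟙 (o ≟ i))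
    ≡⟨ ∑-distrib-+ f (λ i → c * 𝟙 (o ≟ i)) ⟩
  ∑[ i < n ] f i + ∑[ i < n ] (c * 𝟙 (o ≟ i))
    ≡⟨ cong (∑[ i < n ] f i +_) (≡.sym (*-distribˡ-sum c (λ i → 𝟙 (o ≟ i)))) ⟩
  ∑[ i < n ] f i + c * ∑[ i < n ] 𝟙 (o ≟ i)
    ≡⟨ cong (λ x → ∑[ i < n ] f i + c * x) (∑-𝟙≟ o) ⟩
  ∑[ i < n ] f i + c * 1
    ≡⟨ cong (∑[ i < n ] f i +_) (*-identityʳ c) ⟩
  ∑[ i < n ] f i + c ∎
  where open ≡.≡-Reasoning

∑-𝟙-image : ∀ {m n p} {P : Fin n → Set p} (P? : ∀ i → Dec (P i)) (g : Fin m → Fin n)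
          → Injective _≡_ _≡_ g → (∀ a → P (g a)) → (∀ i → P i → ∃ λ a → g a ≡ i)
          → ∑[ i < n ] 𝟙 (P? i) ≡ m
∑-𝟙-image {m} {n} {P = P} P? g g-injective P-g onto = begin
  ∑[ i < n ] 𝟙 (P? i)               ≡⟨ sum-cong-≗ fibre-size ⟩
  ∑[ i < n ] ∑[ a < m ] 𝟙 (g a ≟ i) ≡⟨ ∑-comm (λ i a → 𝟙 (g a ≟ i)) ⟩
  ∑[ a < m ] ∑[ i < n ] 𝟙 (g a ≟ i) ≡⟨ sum-cong-≗ (∑-𝟙≟ ∘ g) ⟩
  ∑[ a < m ] 1                      ≡⟨ ∑-const m 1 ⟩
  m * 1                             ≡⟨ *-identityʳ m ⟩
  m                                 ∎
  where
  open ≡.≡-Reasoning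
  fibre-size : ∀ i → 𝟙 (P? i) ≡ ∑[ a < m ] 𝟙 (g a ≟ i)
  fibre-size i with P? i
  ... | yes Pi with onto i Pi
  ...   | a₀ , ≡.refl = ≡.sym (≡.trans
          (sum-cong-≗ (λ a → 𝟙-cong (≡.sym ∘ g-injective) (cong g ∘ ≡.sym) (g a ≟ g a₀) (a₀ ≟ a)))
          (∑-𝟙≟ a₀))
  fibre-size i | no ¬Pi = ≡.sym (≡.trans
          (sum-cong-≗ (λ a → 𝟙-cong (λ ga≡i → ¬Pi (subst P ga≡i (P-g a))) (λ ()) (g a ≟ i) (no λ ())))
          (sum-replicate-zero m))

funToFin-cong : ∀ {m n} {f g : Fin m → Fin n} → (∀ i → f i ≡ g i) → funToFin f ≡ funToFin g
funToFin-cong {zero}  _   = ≡.refl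
funToFin-cong {suc m} f≗g = cong₂ combine (f≗g zero) (funToFin-cong (f≗g ∘ suc))

module _ (F : Field) where
  open Field F
    using ( Carrier; _≈_; 0#; -_; refl; sym; trans; +-cong; +-congˡ; *-cong; -‿inverseʳ
          ; setoid; commRing; +-abelianGroup; +-commutativeSemigroup; +-group )
    renaming (_+_ to _+ᶠ_; _*_ to _*ᶠ_; _-_ to _-ᶠ_)
  open RingProperties (CommutativeRing.ring commRing) using ([y-z]x≈yx-zx)
  open AbelianGroupProperties +-abelianGroup using (⁻¹-∙-comm)
  open CommutativeSemigroupProperties +-commutativeSemigroup using (interchange)
  open GroupProperties +-group using (x∙y⁻¹≈ε⇒x≈y; x≈y⇒x∙y⁻¹≈ε)
  open import Relation.Binary.Reasoning.Setoid setoid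

  lincomb-cong : ∀ {n m} {x y : Fin m → Carrier} (b : Fin m → Vect F n)
               → (∀ i → x i ≈ y i) → _≈ᵥ_ F (lincomb F x b) (lincomb F y b)
  lincomb-cong {m = zero}  b x≈y t = refl
  lincomb-cong {m = suc m} b x≈y t = +-cong (*-cong (x≈y zero) refl) (lincomb-cong (b ∘ suc) (x≈y ∘ suc) t)

  lincomb-∈ : ∀ {n m} (N : Subspace F n) {b : Fin m → Vect F n}
            → (∀ i → _∈S N (b i)) → ∀ x → _∈S N (lincomb F x b)
  lincomb-∈ {m = zero}  N b∈N x = 0∈ N
  lincomb-∈ {m = suc m} N b∈N x = +∈ N (·∈ N (x zero) (b∈N zero)) (lincomb-∈ N (b∈N ∘ suc) (x ∘ suc))

  lincomb-sub : ∀ {n m} (x y : Fin m → Carrier) (b : Fin m → Vect F n) t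
              → lincomb F (λ i → x i -ᶠ y i) b t ≈ lincomb F x b t -ᶠ lincomb F y b t
  lincomb-sub {m = zero}  x y b t = sym (-‿inverseʳ 0#)
  lincomb-sub {m = suc m} x y b t = begin
    (x₀ -ᶠ y₀) *ᶠ b₀ +ᶠ lincomb F (λ i → x (suc i) -ᶠ y (suc i)) (b ∘ suc) t
      ≈⟨ +-cong ([y-z]x≈yx-zx b₀ x₀ y₀) (lincomb-sub (x ∘ suc) (y ∘ suc) (b ∘ suc) t) ⟩
    (x₀ *ᶠ b₀ -ᶠ y₀ *ᶠ b₀) +ᶠ (X -ᶠ Y)
      ≈⟨ interchange (x₀ *ᶠ b₀) (- (y₀ *ᶠ b₀)) X (- Y) ⟩
    (x₀ *ᶠ b₀ +ᶠ X) +ᶠ (- (y₀ *ᶠ b₀) +ᶠ - Y)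
      ≈⟨ +-congˡ (⁻¹-∙-comm (y₀ *ᶠ b₀) Y) ⟩
    (x₀ *ᶠ b₀ +ᶠ X) -ᶠ (y₀ *ᶠ b₀ +ᶠ Y) ∎
    where
    x₀ y₀ b₀ X Y : Carrier
    x₀ = x zero
    y₀ = y zero
    b₀ = b zero t
    X = lincomb F (x ∘ suc) (b ∘ suc) t
    Y = lincomb F (y ∘ suc) (b ∘ suc) t

  lincomb-injective : ∀ {n m} {b : Fin m → Vect F n} → LinearlyIndependent F b
                    → ∀ {x y} → _≈ᵥ_ F (lincomb F x b) (lincomb F y b) → ∀ i → x i ≈ y i
  lincomb-injective {b = b} independent {x} {y} x≈y i = x∙y⁻¹≈ε⇒x≈y (x i) (y i)
    (independent (λ j → x j -ᶠ y j) (λ t → trans (lincomb-sub x y b t) (x≈y⇒x∙y⁻¹≈ε (x≈y t))) i)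

module _ {F : Field} where

  _∩_ : ∀ {n} → Subspace F n → Subspace F n → Subspace F n
  M ∩ N = record
    { _∈S    = λ v → _∈S M v × _∈S N v
    ; ∈-resp = λ u≈v (u∈M , u∈N) → ∈-resp M u≈v u∈M , ∈-resp N u≈v u∈N
    ; 0∈     = 0∈ M , 0∈ N
    ; +∈     = λ (u∈M , u∈N) (v∈M , v∈N) → +∈ M u∈M v∈M , +∈ N u∈N v∈N
    ; ·∈     = λ a (v∈M , v∈N) → ·∈ M a v∈M , ·∈ N a v∈N
    ; ∈?     = λ v → ∈? M v ×-dec ∈? N v
    }

  count≡∑𝟙 : ∀ {n s} (M : Fin s → Subspace F n) v → count F M v ≡ ∑[ j < s ] 𝟙 (∈? (M j) v)
  count≡∑𝟙 {s = zero}  M v = ≡.refl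
  count≡∑𝟙 {s = suc s} M v with ∈? (M zero) v
  ... | yes _ = cong suc (count≡∑𝟙 (M ∘ suc) v)
  ... | no _  = count≡∑𝟙 (M ∘ suc) v

  ∈-all⇒count≡s : ∀ {n s} (M : Fin s → Subspace F n) {v} → (∀ j → _∈S (M j) v) → count F M v ≡ s
  ∈-all⇒count≡s {s = zero}  M v∈M = ≡.refl
  ∈-all⇒count≡s {s = suc s} M {v} v∈M with ∈? (M zero) v
  ... | yes _     = cong suc (∈-all⇒count≡s (M ∘ suc) (v∈M ∘ suc))
  ... | no v∉M₀  = ⊥-elim (v∉M₀ (v∈M zero))

  ∈⇒count≢0 : ∀ {n s} (M : Fin s → Subspace F n) j {v} → _∈S (M j) v → count F M v ≢ 0
  ∈⇒count≢0 {s = suc s} M j {v} v∈Mj with ∈? (M zero) v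
  ∈⇒count≢0 M j       v∈Mj | yes _ = λ ()
  ∈⇒count≢0 M zero    v∈M₀ | no v∉M₀ = ⊥-elim (v∉M₀ v∈M₀)
  ∈⇒count≢0 M (suc j) v∈Mj | no _    = ∈⇒count≢0 (M ∘ suc) j v∈Mj

module Counting {q} (𝔽 : FiniteField q) where
  open FiniteField 𝔽 using (field'; Carrier; _≈_; refl; sym; trans; enum; enum-inj; enum-surj)
  private
    F : Field
    F = field'

  index : Carrier → Fin q
  index x = proj₁ (enum-surj x)

  index-cong : ∀ {x y} → x ≈ y → index x ≡ index y
  index-cong {x} {y} x≈y = enum-inj _ _ (trans (proj₂ (enum-surj x)) (trans x≈y (sym (proj₂ (enum-surj y)))))

  index-enum : ∀ i → index (enum i) ≡ i
  index-enum i = enum-inj _ _ (proj₂ (enum-surj (enum i)))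

  -- F^n is enumerated by Fin (q ^ n) through base-q digits, so sums over F^n are finite sums.
  toVec : ∀ {n} → Fin (q ^ n) → Vect F n
  toVec {n} i t = enum (finToFun {q} {n} i t)

  fromVec : ∀ {n} → Vect F n → Fin (q ^ n)
  fromVec v = funToFin (index ∘ v)

  toVec-fromVec : ∀ {n} (v : Vect F n) → _≈ᵥ_ F (toVec (fromVec v)) v
  toVec-fromVec v t = subst (λ j → enum j ≈ v t) (≡.sym (finToFun-funToFin (index ∘ v) t)) (proj₂ (enum-surj (v t)))

  fromVec-toVec : ∀ {n} (i : Fin (q ^ n)) → fromVec (toVec {n} i) ≡ i
  fromVec-toVec {n} i = ≡.trans (funToFin-cong (index-enum ∘ finToFun {q} {n} i)) (funToFin-finToFin {n} i)

  fromVec-cong : ∀ {n} {u v : Vect F n} → _≈ᵥ_ F u v → fromVec u ≡ fromVec v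
  fromVec-cong u≈v = funToFin-cong (index-cong ∘ u≈v)

  fromVec-injective : ∀ {n} {u v : Vect F n} → fromVec u ≡ fromVec v → _≈ᵥ_ F u v
  fromVec-injective {n} {u} {v} eq t =
    trans (sym (toVec-fromVec u t)) (subst (λ i → toVec {n} i t ≈ v t) (≡.sym eq) (toVec-fromVec v t))

  toVec-injective : ∀ {n} {i j : Fin (q ^ n)} → _≈ᵥ_ F (toVec {n} i) (toVec j) → i ≡ j
  toVec-injective {n} {i} {j} eq =
    ≡.trans (≡.sym (fromVec-toVec {n} i)) (≡.trans (fromVec-cong eq) (fromVec-toVec {n} j))

  ∣_∣ : ∀ {n} → Subspace F n → ℕ
  ∣_∣ {n} N = ∑[ i < q ^ n ] 𝟙 (∈? N (toVec i))

  ∣∣≡q^dim : ∀ {n m} (N : Subspace F n) → HasDim F (_∈S N) m → ∣ N ∣ ≡ q ^ m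
  ∣∣≡q^dim {n} {m} N (b , b∈N , independent , spanning) =
    ∑-𝟙-image (∈? N ∘ toVec) embed embed-injective embed-∈ embed-onto
    where
    embed : Fin (q ^ m) → Fin (q ^ n)
    embed a = fromVec (lincomb F (toVec a) b)

    embed-injective : Injective _≡_ _≡_ embed
    embed-injective = toVec-injective {m} ∘ lincomb-injective F independent ∘ fromVec-injective {n}

    embed-∈ : ∀ a → _∈S N (toVec (embed a))
    embed-∈ a = ∈-resp N (λ t → sym (toVec-fromVec _ t)) (lincomb-∈ F N b∈N (toVec a))

    embed-onto : ∀ i → _∈S N (toVec i) → ∃ λ a → embed a ≡ i
    embed-onto i i∈N with spanning (toVec i) i∈N
    ... | c , i≈c = fromVec c , (begin
      fromVec (lincomb F (toVec (fromVec c)) b) ≡⟨ fromVec-cong (lincomb-cong F b (toVec-fromVec c)) ⟩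
      fromVec (lincomb F c b)                   ≡⟨ fromVec-cong (λ t → sym (i≈c t)) ⟩
      fromVec (toVec {n} i)                     ≡⟨ fromVec-toVec {n} i ⟩
      i                                         ∎)
      where open ≡.≡-Reasoning

  ∑-count≡∑∣∩∣ : ∀ {n s} (N : Subspace F n) (M : Fin s → Subspace F n)
               → ∑[ i < q ^ n ] (𝟙 (∈? N (toVec i)) * count F M (toVec i)) ≡ ∑[ j < s ] ∣ N ∩ M j ∣
  ∑-count≡∑∣∩∣ {n} {s} N M = begin
    ∑[ i < q ^ n ] (𝟙 (∈? N (v i)) * count F M (v i))
      ≡⟨ sum-cong-≗ (λ i → cong (𝟙 (∈? N (v i)) *_) (count≡∑𝟙 M (v i))) ⟩
    ∑[ i < q ^ n ] (𝟙 (∈? N (v i)) * ∑[ j < s ] 𝟙 (∈? (M j) (v i)))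
      ≡⟨ sum-cong-≗ (λ i → *-distribˡ-sum (𝟙 (∈? N (v i))) (λ j → 𝟙 (∈? (M j) (v i)))) ⟩
    ∑[ i < q ^ n ] ∑[ j < s ] (𝟙 (∈? N (v i)) * 𝟙 (∈? (M j) (v i)))
      ≡⟨ ∑-comm (λ i j → 𝟙 (∈? N (v i)) * 𝟙 (∈? (M j) (v i))) ⟩
    ∑[ j < s ] ∑[ i < q ^ n ] (𝟙 (∈? N (v i)) * 𝟙 (∈? (M j) (v i)))
      ≡⟨ sum-cong-≗ (λ j → sum-cong-≗ (λ i → ≡.sym (𝟙-×-dec (∈? N (v i)) (∈? (M j) (v i))))) ⟩
    ∑[ j < s ] ∣ N ∩ M j ∣ ∎
    where
    open ≡.≡-Reasoning
    v : Fin (q ^ n) → Vect F n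
    v = toVec

  ∑-count+d≡d*∣∣+s : ∀ {n s d} (N : Subspace F n) (M : Fin s → Subspace F n)
                   → (∀ v → _∈S N v → NonZeroVec F v → count F M v ≡ d)
                   → ∑[ i < q ^ n ] (𝟙 (∈? N (toVec i)) * count F M (toVec i)) + d ≡ d * ∣ N ∣ + s
  ∑-count+d≡d*∣∣+s {n} {s} {d} N M count≡d = begin
    ∑[ i < q ^ n ] (𝟙 (∈? N (v i)) * count F M (v i)) + d
      ≡⟨ ≡.sym (∑-+-point-mass (λ i → 𝟙 (∈? N (v i)) * count F M (v i)) d o) ⟩
    ∑[ i < q ^ n ] (𝟙 (∈? N (v i)) * count F M (v i) + d * 𝟙 (o ≟ i))
      ≡⟨ sum-cong-≗ pointwise ⟩
    ∑[ i < q ^ n ] (d * 𝟙 (∈? N (v i)) + s * 𝟙 (o ≟ i))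
      ≡⟨ ∑-+-point-mass (λ i → d * 𝟙 (∈? N (v i))) s o ⟩
    ∑[ i < q ^ n ] (d * 𝟙 (∈? N (v i))) + s
      ≡⟨ cong (_+ s) (≡.sym (*-distribˡ-sum d (λ i → 𝟙 (∈? N (v i))))) ⟩
    d * ∣ N ∣ + s ∎
    where
    open ≡.≡-Reasoning
    v : Fin (q ^ n) → Vect F n
    v = toVec
    o : Fin (q ^ n)
    o = fromVec {n} (0ᵥ F)
    v-o≈0 : _≈ᵥ_ F (0ᵥ F) (v o)
    v-o≈0 t = sym (toVec-fromVec (0ᵥ F) t)
    -- o indexes the zero vector, the only vector of N whose count is s rather than d.
    pointwise : ∀ i → 𝟙 (∈? N (v i)) * count F M (v i) + d * 𝟙 (o ≟ i) ≡ d * 𝟙 (∈? N (v i)) + s * 𝟙 (o ≟ i)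
    pointwise i with o ≟ i | ∈? N (v i)
    ... | yes ≡.refl | yes _   =
      ≡.trans (cong (λ c → 1 * c + d * 1) (∈-all⇒count≡s M (λ j → ∈-resp (M j) v-o≈0 (0∈ (M j))))) (solve (d ∷ s ∷ []))
    ... | yes ≡.refl | no o∉N  = ⊥-elim (o∉N (∈-resp N v-o≈0 (0∈ N)))
    ... | no o≢i     | yes i∈N =
      ≡.trans (cong (λ c → 1 * c + d * 0) (count≡d (v i) i∈N (o≢i ∘ fromVec-zero))) (solve (d ∷ s ∷ []))
      where
      fromVec-zero : _≈ᵥ_ F (v i) (0ᵥ F) → o ≡ i
      fromVec-zero vi≈0 = ≡.trans (≡.sym (fromVec-cong vi≈0)) (fromVec-toVec {n} i)
    ... | no _       | no _    = solve (d ∷ s ∷ [])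

  ∣N∩N∣≡∣N∣ : ∀ {n} (N : Subspace F n) → ∣ N ∩ N ∣ ≡ ∣ N ∣
  ∣N∩N∣≡∣N∣ N = sum-cong-≗ (λ i → 𝟙-cong proj₁ (λ p → p , p) (∈? (N ∩ N) (toVec i)) (∈? N (toVec i)))

  ∑-count≡q^a+s*q^b : ∀ {n s a b} (M : Fin (suc s) → Subspace F n)
                    → HasDim F (_∈S (M zero)) a → (∀ j → HasDim F (_∈S (M zero ∩ M (suc j))) b)
                    → ∑[ i < q ^ n ] (𝟙 (∈? (M zero) (toVec i)) * count F M (toVec i)) ≡ q ^ a + s * q ^ b
  ∑-count≡q^a+s*q^b {n} {s} {a} {b} M dim-M₀ dim-M₀∩M = begin
    ∑[ i < q ^ n ] (𝟙 (∈? (M zero) (toVec i)) * count F M (toVec i))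
      ≡⟨ ∑-count≡∑∣∩∣ (M zero) M ⟩
    ∣ M zero ∩ M zero ∣ + ∑[ j < s ] ∣ M zero ∩ M (suc j) ∣
      ≡⟨ cong₂ _+_ (≡.trans (∣N∩N∣≡∣N∣ (M zero)) (∣∣≡q^dim (M zero) dim-M₀))
                   (sum-cong-≗ (λ j → ∣∣≡q^dim (M zero ∩ M (suc j)) (dim-M₀∩M j))) ⟩
    q ^ a + ∑[ j < s ] (q ^ b)
      ≡⟨ cong (q ^ a +_) (∑-const s (q ^ b)) ⟩
    q ^ a + s * q ^ b ∎
    where open ≡.≡-Reasoning

n∸2k+k≡n∸k : ∀ n k → 2 * k ≤ n → n ∸ 2 * k + k ≡ n ∸ k
n∸2k+k≡n∸k n k 2k≤n = begin
  n ∸ 2 * k + k            ≡⟨ ≡.sym (m+n∸n≡m (n ∸ 2 * k + k) k) ⟩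
  n ∸ 2 * k + k + k ∸ k    ≡⟨ cong (_∸ k) (+-assoc (n ∸ 2 * k) k k) ⟩
  n ∸ 2 * k + (k + k) ∸ k  ≡⟨ cong (λ m → n ∸ 2 * k + (k + m) ∸ k) (≡.sym (+-identityʳ k)) ⟩
  n ∸ 2 * k + 2 * k ∸ k    ≡⟨ cong (_∸ k) (m∸n+n≡m 2k≤n) ⟩
  n ∸ k                    ∎
  where open ≡.≡-Reasoning

cancel-double-count : ∀ a b s d → suc a + s * suc b + suc d ≡ suc d * suc a + suc s → s * b ≡ d * a
cancel-double-count a b s d eq = +-cancelˡ-≡ (2 + a + s + d) (s * b) (d * a) (begin
  2 + a + s + d + s * b      ≡⟨ solve (a ∷ b ∷ s ∷ d ∷ []) ⟩
  suc a + s * suc b + suc d  ≡⟨ eq ⟩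
  suc d * suc a + suc s      ≡⟨ solve (a ∷ b ∷ s ∷ d ∷ []) ⟩
  2 + a + s + d + d * a      ∎)
  where open ≡.≡-Reasoning

solve-double-count : ∀ {A B Q s d} → A ≡ B * Q → 1 ≤ B → 1 ≤ Q
                   → A + s * B + suc d ≡ suc d * A + suc s
                   → (suc s * (B ∸ 1) ≡ d * (A ∸ 1) + (B ∸ 1))
                   × (suc s * (B ∸ 1) ≡ suc d * (A ∸ 1) ∸ B * (Q ∸ 1))
solve-double-count {zero}  {suc b} {suc _} () _ _ _
solve-double-count {suc a} {suc b} {Q} {s} {d} A≡BQ _ 1≤Q eq = first , second
  where
  open ≡.≡-Reasoning
  s*b≡d*a : s * b ≡ d * a
  s*b≡d*a = cancel-double-count a b s d eq
  b≤a : b ≤ a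
  b≤a = s≤s⁻¹ (subst (suc b ≤_) (≡.sym A≡BQ) (m≤m*n (suc b) Q {{>-nonZero 1≤Q}}))
  first : suc s * b ≡ d * a + b
  first = ≡.trans (cong (b +_) s*b≡d*a) (+-comm b (d * a))
  second : suc s * b ≡ suc d * a ∸ suc b * (Q ∸ 1)
  second = begin
    b + s * b                    ≡⟨ cong (b +_) s*b≡d*a ⟩
    b + d * a                    ≡⟨ cong (_+ d * a) (≡.sym (m∸[m∸n]≡n b≤a)) ⟩
    a ∸ (a ∸ b) + d * a          ≡⟨ ≡.sym (+-∸-comm (d * a) (m∸n≤m a b)) ⟩
    a + d * a ∸ (a ∸ b)          ≡⟨ cong (a + d * a ∸_) (≡.sym (≡.trans (*-distribˡ-∸ (suc b) Q 1)
                                      (cong₂ _∸_ (≡.sym A≡BQ) (*-identityʳ (suc b))))) ⟩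
    a + d * a ∸ suc b * (Q ∸ 1)  ∎

lemma5p9 : ∀ {q : ℕ} (𝔽 : FiniteField q) (n k s d : ℕ)
    → 1 ≤ k → 2 * k ≤ n → 2 ≤ s → 2 ≤ d
    → (M : Fin s → Subspace (FiniteField.field' 𝔽) n)
    → (∀ i j → i ≢ j → ¬ SameSubspace (FiniteField.field' 𝔽) (M i) (M j))
    → (∀ i → HasDim (FiniteField.field' 𝔽) (_∈S (M i)) (n ∸ k))
    → (∀ v → NonZeroVec (FiniteField.field' 𝔽) v → count (FiniteField.field' 𝔽) M v ≡ 0 ⊎ count (FiniteField.field' 𝔽) M v ≡ d)
    → Σ (Vect (FiniteField.field' 𝔽) n) (λ v → NonZeroVec (FiniteField.field' 𝔽) v × count (FiniteField.field' 𝔽) M v ≡ 0)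
    → Σ (Vect (FiniteField.field' 𝔽) n) (λ v → NonZeroVec (FiniteField.field' 𝔽) v × count (FiniteField.field' 𝔽) M v ≡ d)
    → (∀ i j → i ≢ j → HasDim (FiniteField.field' 𝔽) (λ v → _∈S (M i) v × _∈S (M j) v) (n ∸ 2 * k))
    → (s * (q ^ (n ∸ 2 * k) ∸ 1) ≡ (d ∸ 1) * (q ^ (n ∸ k) ∸ 1) + (q ^ (n ∸ 2 * k) ∸ 1))
      × (s * (q ^ (n ∸ 2 * k) ∸ 1) ≡ d * (q ^ (n ∸ k) ∸ 1) ∸ q ^ (n ∸ 2 * k) * (q ^ k ∸ 1))
lemma5p9 {q} 𝔽 n k (suc s) (suc d) _ 2k≤n (s≤s _) (s≤s _) M _ dim-M count∈0d _ _ dim-M∩M =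
  solve-double-count A≡B*q^k (m^n>0 q {{q≢0}} (n ∸ 2 * k)) (m^n>0 q {{q≢0}} k) (begin
    A + s * B + suc d           ≡⟨ cong (_+ suc d) (≡.sym (∑-count≡q^a+s*q^b M (dim-M zero) dim-M₀∩M)) ⟩
    ∑-count + suc d             ≡⟨ ∑-count+d≡d*∣∣+s (M zero) M count≡d ⟩
    suc d * ∣ M zero ∣ + suc s  ≡⟨ cong (λ x → suc d * x + suc s) (∣∣≡q^dim (M zero) (dim-M zero)) ⟩
    suc d * A + suc s           ∎)
  where
  open ≡.≡-Reasoning
  open Counting 𝔽
  F : Field
  F = FiniteField.field' 𝔽
  A B : ℕ
  A = q ^ (n ∸ k)
  B = q ^ (n ∸ 2 * k)
  ∑-count : ℕ
  ∑-count = ∑[ i < q ^ n ] (𝟙 (∈? (M zero) (toVec i)) * count F M (toVec i))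

  q≢0 : NonZero q
  q≢0 = nonZeroIndex (index (FiniteField.0# 𝔽))

  A≡B*q^k : A ≡ B * q ^ k
  A≡B*q^k = ≡.trans (cong (q ^_) (≡.sym (n∸2k+k≡n∸k n k 2k≤n))) (^-distribˡ-+-* q (n ∸ 2 * k) k)

  dim-M₀∩M : ∀ j → HasDim F (_∈S (M zero ∩ M (suc j))) (n ∸ 2 * k)
  dim-M₀∩M j = dim-M∩M zero (suc j) λ ()

  count≡d : ∀ v → _∈S (M zero) v → NonZeroVec F v → count F M v ≡ suc d
  count≡d v v∈M₀ v≢0 = fromInj₂ (⊥-elim ∘ ∈⇒count≢0 M zero v∈M₀) (count∈0d v v≢0)
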